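{- Let $N\in\mathbb Z[\mathbf i]\setminus\{0\}$, $m\in\mathbb Z[\mathbf i]$ with $m\mid N$, $x\in\Omega_{N/m}$, and $\alpha^N(m,x)=\begin{pmatrix}m&x\\0&N/m\end{pmatrix}$. Then $$\mathrm{SL}_2(\mathbb Z[\mathbf i])\,\alpha^N(m,x)=\Xi_1\alpha^N(m,x)\ \sqcup\ \Xi_2\alpha^N(m,x)\ \sqcup\ \Xi_{12}\alpha^N(m,x),$$ each of these three sets is closed under left multiplication by the group $\Xi_{12}$, and each equals exactly one $\Xi_{12}$-orbit in $\mathrm{SL}_2(\mathbb Z[\mathbf i])\alpha^N(m,x)$.
   Context: For $y\in\mathbb Z[\mathbf i]\setminus\{0\}$, $\Omega_y$ is a fixed complete set of representatives of $\mathbb Z[\mathbf i]/(y)$. Let $\mathrm{red}:\mathrm{SL}_2(\mathbb Z[\mathbf i])\to\mathrm{SL}_2(\mathbb Z[\mathbf i]/(1+\mathbf i))$ be entrywise reduction modulo $1+\mathbf i$, with $\mathbb Z[\mathbf i]/(1+\mathbf i)$ identified with $\{0,1\}$. Define $\Xi_{12}=\mathrm{red}^{ -1}\{\begin{pmatrix}1&0\\0&1\end{pmatrix},\begin{pmatrix}0&1\\1&0\end{pmatrix}\}$ (a subgroup), $\Xi_1=\mathrm{red}^{ -1}\{\begin{pmatrix}0&1\\1&1\end{pmatrix},\begin{pmatrix}1&1\\0&1\end{pmatrix}\}$, $\Xi_2=\mathrm{red}^{ -1}\{\begin{pmatrix}1&1\\1&0\end{pmatrix},\begin{pmatrix}1&0\\1&1\end{pmatrix}\}$.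 -}

module Defs where

open import Data.Integer as ℤ using (ℤ; +_; -[1+_])
open import Data.Product using (Σ; ∃; _×_; _,_)
open import Data.Sum using (_⊎_)
open import Data.Empty using (⊥)
open import Relation.Nullary using (¬_)
open import Relation.Binary.PropositionalEquality using (_≡_)

record GI : Set where
  constructor _+i_
  field
    re : ℤ
    im : ℤ
open GI public

infixl 6 _+ᵍ_ _-ᵍ_
infixl 7 _*ᵍ_

_+ᵍ_ : GI → GI → GI
(a +i b) +ᵍ (c +i d) = (a ℤ.+ c) +i (b ℤ.+ d)

-ᵍ_ : GI → GI
-ᵍ (a +i b) = (ℤ.- a) +i (ℤ.- b)

_-ᵍ_ : GI → GI → GI
z -ᵍ w = z +ᵍ (-ᵍ w)

_*ᵍ_ : GI → GI → GI
(a +i b) *ᵍ (c +i d) = ((a ℤ.* c) ℤ.- (b ℤ.* d)) +i ((a ℤ.* d) ℤ.+ (b ℤ.* c))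

0ᵍ 1ᵍ 𝐢 : GI
0ᵍ = (+ 0) +i (+ 0)
1ᵍ = (+ 1) +i (+ 0)
𝐢  = (+ 0) +i (+ 1)

_∣ᵍ_ : GI → GI → Set
y ∣ᵍ z = ∃ λ c → z ≡ y *ᵍ c

record M2 : Set where
  constructor mat
  field
    a b c d : GI
open M2 public

infixl 7 _·_
_·_ : M2 → M2 → M2
mat a₁ b₁ c₁ d₁ · mat a₂ b₂ c₂ d₂ =
  mat (a₁ *ᵍ a₂ +ᵍ b₁ *ᵍ c₂) (a₁ *ᵍ b₂ +ᵍ b₁ *ᵍ d₂)
      (c₁ *ᵍ a₂ +ᵍ d₁ *ᵍ c₂) (c₁ *ᵍ b₂ +ᵍ d₁ *ᵍ d₂)

det : M2 → GI
det (mat a b c d) = a *ᵍ d -ᵍ b *ᵍ c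

SL₂ : M2 → Set
SL₂ M = det M ≡ 1ᵍ

-- Reduction modulo (1+i); ℤ[i]/(1+i) identified with {0,1} ⊂ ℤ[i].
-- "red z = r" means (1+i) ∣ (z - r).
1+𝐢 : GI
1+𝐢 = 1ᵍ +ᵍ 𝐢

RedIs : GI → GI → Set
RedIs z r = 1+𝐢 ∣ᵍ (z -ᵍ r)

RedMatIs : M2 → M2 → Set
RedMatIs M R = RedIs (a M) (a R) × RedIs (b M) (b R) × RedIs (c M) (c R) × RedIs (d M) (d R)

matI matW mat0111 mat1101 mat1110 mat1011 : M2
matI    = mat 1ᵍ 0ᵍ 0ᵍ 1ᵍ
matW    = mat 0ᵍ 1ᵍ 1ᵍ 0ᵍ
mat0111 = mat 0ᵍ 1ᵍ 1ᵍ 1ᵍ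
mat1101 = mat 1ᵍ 1ᵍ 0ᵍ 1ᵍ
mat1110 = mat 1ᵍ 1ᵍ 1ᵍ 0ᵍ
mat1011 = mat 1ᵍ 0ᵍ 1ᵍ 1ᵍ

Ξ₁₂ Ξ₁ Ξ₂ : M2 → Set
Ξ₁₂ M = SL₂ M × (RedMatIs M matI ⊎ RedMatIs M matW)
Ξ₁  M = SL₂ M × (RedMatIs M mat0111 ⊎ RedMatIs M mat1101)
Ξ₂  M = SL₂ M × (RedMatIs M mat1110 ⊎ RedMatIs M mat1011)

_⋆_ : (M2 → Set) → M2 → (M2 → Set)
(S ⋆ α) M = ∃ λ g → S g × M ≡ g · α

IsCompleteReps : (GI → Set) → GI → Set
IsCompleteReps Ωy y =
  (∀ z → ∃ λ w → Ωy w × y ∣ᵍ (z -ᵍ w)) ×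
  (∀ w w' → Ωy w → Ωy w' → y ∣ᵍ (w -ᵍ w') → w ≡ w')

-- α^N(m,x) with N/m = k
α : GI → GI → GI → M2
α m x k = mat m x 0ᵍ k

_⊆_ : (M2 → Set) → (M2 → Set) → Set
A ⊆ B = ∀ M → A M → B M

_≐_ : (M2 → Set) → (M2 → Set) → Set
A ≐ B = A ⊆ B × B ⊆ A

Disjoint : (M2 → Set) → (M2 → Set) → Set
Disjoint A B = ∀ M → A M → B M → ⊥

ClosedΞ₁₂ : (M2 → Set) → Set
ClosedΞ₁₂ A = ∀ h M → Ξ₁₂ h → A M → A (h · M)

IsΞ₁₂OrbitIn : (M2 → Set) → (M2 → Set) → Set
IsΞ₁₂OrbitIn X A = ∃ λ M₀ → X M₀ × (A ≐ (Ξ₁₂ ⋆ M₀))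

{-# OPTIONS --safe #-}
-- Reduction modulo 1 + i is a ring homomorphism red : ℤ[i] → 𝔽₂ (the parity of re z + im z), so it
-- induces a group homomorphism SL₂(ℤ[i]) → SL₂(𝔽₂) ≅ S₃.  There the images of Ξ₁₂, Ξ₁, Ξ₂ are the
-- subgroup {I, W} of order 2 and its two other right cosets; pulling back, Ξ₁ = Ξ₁₂ g₁ and
-- Ξ₂ = Ξ₁₂ g₂ for explicit g₁, g₂, and SL₂(ℤ[i]) = Ξ₁ ⊔ Ξ₂ ⊔ Ξ₁₂.  As ℤ[i] is a domain and
-- m, N/m ≠ 0, the map g ↦ g α is injective, so these three right cosets are carried onto the
-- disjoint Ξ₁₂-orbits of g₁ α, g₂ α and α, which cover SL₂(ℤ[i]) α.
module Submission where

open import Defs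
open import Relation.Binary.PropositionalEquality
open import Algebra.Bundles using (CommutativeRing)
open import Algebra.Consequences.Propositional using (comm∧idˡ⇒id; comm∧invˡ⇒inv; comm∧distrˡ⇒distrʳ)
open import Algebra.Definitions {A = GI} _≡_ using (Associative; Commutative; LeftIdentity; LeftInverse; _DistributesOverˡ_)
import Algebra.Properties.Group as GroupProperties
import Algebra.Properties.Ring as RingProperties
open import Algebra.Structures {A = GI} _≡_ using (IsCommutativeRing)
open import Data.Empty using (⊥; ⊥-elim)
open import Data.Integer.Base as ℤ using (ℤ; +_; -[1+_]; _+_; _*_; -_; _-_; _⊖_; ∣_∣)
import Data.Integer.Properties as ℤ
open import Data.Integer.Tactic.RingSolver using (solve-∀)
open import Data.Maybe.Base using (Maybe; just; nothing)
open import Data.Nat.Base as ℕ using (zero; suc)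
import Data.Nat.Properties as ℕ
open import Data.Parity.Base as ℙ using (Parity; 0ℙ; 1ℙ)
import Data.Parity.Properties as ℙ
open import Data.Product using (∃; _×_; _,_; proj₁; proj₂; uncurry)
import Data.Sign.Properties as Sign
open import Data.Sum.Base as Sum using (_⊎_; inj₁; inj₂)
open import Function using (_∘_; id)
open import Level using (0ℓ)
open import Relation.Nullary using (¬_)
import Tactic.RingSolver as Solver
open import Tactic.RingSolver.Core.AlmostCommutativeRing using (AlmostCommutativeRing; fromCommutativeRing)

-- Parity of integers

parity : ℤ → Parity
parity i = ℕ.parity ∣ i ∣

parity-suc-+-suc : ∀ m n → ℕ.parity (suc m) ℙ.+ ℕ.parity (suc n) ≡ ℕ.parity m ℙ.+ ℕ.parity n
parity-suc-+-suc m n = begin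
  ℕ.parity (suc m) ℙ.+ ℕ.parity (suc n) ≡⟨ ℙ.+-homo-+ (suc m) (suc n) ⟨
  ℕ.parity (suc (m ℕ.+ suc n))          ≡⟨ cong (ℕ.parity ∘ suc) (ℕ.+-suc m n) ⟩
  ℕ.parity (m ℕ.+ n)                    ≡⟨ ℙ.+-homo-+ m n ⟩
  ℕ.parity m ℙ.+ ℕ.parity n             ∎
  where open ≡-Reasoning

parity-⊖ : ∀ m n → parity (m ⊖ n) ≡ ℕ.parity m ℙ.+ ℕ.parity n
parity-⊖ m       zero    = sym (ℙ.+-identityʳ (ℕ.parity m))
parity-⊖ zero    (suc n) = refl
parity-⊖ (suc m) (suc n) = begin
  parity (suc m ⊖ suc n)                ≡⟨ cong parity (ℤ.[1+m]⊖[1+n]≡m⊖n m n) ⟩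
  parity (m ⊖ n)                        ≡⟨ parity-⊖ m n ⟩
  ℕ.parity m ℙ.+ ℕ.parity n             ≡⟨ parity-suc-+-suc m n ⟨
  ℕ.parity (suc m) ℙ.+ ℕ.parity (suc n) ∎
  where open ≡-Reasoning

parity-+ : ∀ i j → parity (i + j) ≡ parity i ℙ.+ parity j
parity-+ (+ m)    (+ n)    = ℙ.+-homo-+ m n
parity-+ (+ m)    -[1+ n ] = parity-⊖ m (suc n)
parity-+ -[1+ m ] (+ n)    = trans (parity-⊖ n (suc m)) (ℙ.+-comm (ℕ.parity n) _)
parity-+ -[1+ m ] -[1+ n ] = trans (ℙ.+-homo-+ m n) (sym (parity-suc-+-suc m n))

parity-* : ∀ i j → parity (i * j) ≡ parity i ℙ.* parity j
parity-* i j = trans (cong ℕ.parity (ℤ.abs-* i j)) (ℙ.*-homo-* ∣ i ∣ ∣ j ∣)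

parity-neg : ∀ i → parity (- i) ≡ parity i
parity-neg i = cong ℕ.parity (ℤ.∣-i∣≡∣i∣ i)

parityℕ≡0ℙ⇒even : ∀ n → ℕ.parity n ≡ 0ℙ → ∃ λ q → n ≡ q ℕ.+ q
parityℕ≡0ℙ⇒even zero          _  = 0 , refl
parityℕ≡0ℙ⇒even (suc (suc n)) eq with parityℕ≡0ℙ⇒even n eq
... | q , n≡q+q = suc q , cong suc (trans (cong suc n≡q+q) (sym (ℕ.+-suc q q)))

parity≡0ℙ⇒even : ∀ i → parity i ≡ 0ℙ → ∃ λ q → i ≡ q + q
parity≡0ℙ⇒even i eq with parityℕ≡0ℙ⇒even ∣ i ∣ eq
parity≡0ℙ⇒even (+ n)    _ | q , n≡q+q = + q , trans (cong +_ n≡q+q) (ℤ.pos-+ q q)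
parity≡0ℙ⇒even -[1+ n ] _ | q , n≡q+q = - + q , (begin
  - + suc n       ≡⟨ cong (-_ ∘ +_) n≡q+q ⟩
  - + (q ℕ.+ q)   ≡⟨ cong -_ (ℤ.pos-+ q q) ⟩
  - (+ q + + q)   ≡⟨ ℤ.neg-distrib-+ (+ q) (+ q) ⟩
  - + q + - + q   ∎)
  where open ≡-Reasoning

parity-i+i : ∀ i → parity (i + i) ≡ 0ℙ
parity-i+i i = trans (parity-+ i i) (ℙ.p+p≡0ℙ (parity i))

-- ℤ[i] as a commutative ring and an integral domain

+ᵍ-assoc : Associative _+ᵍ_
+ᵍ-assoc (a +i b) (c +i d) (e +i f) = cong₂ _+i_ (ℤ.+-assoc a c e) (ℤ.+-assoc b d f)

+ᵍ-comm : Commutative _+ᵍ_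
+ᵍ-comm (a +i b) (c +i d) = cong₂ _+i_ (ℤ.+-comm a c) (ℤ.+-comm b d)

+ᵍ-identityˡ : LeftIdentity 0ᵍ _+ᵍ_
+ᵍ-identityˡ (a +i b) = cong₂ _+i_ (ℤ.+-identityˡ a) (ℤ.+-identityˡ b)

-ᵍ-inverseˡ : LeftInverse 0ᵍ -ᵍ_ _+ᵍ_
-ᵍ-inverseˡ (a +i b) = cong₂ _+i_ (ℤ.+-inverseˡ a) (ℤ.+-inverseˡ b)

*ᵍ-assoc : Associative _*ᵍ_
*ᵍ-assoc (a +i b) (c +i d) (e +i f) = cong₂ _+i_ (re-part a b c d e f) (im-part a b c d e f)
  where
  re-part : ∀ a b c d e f → (a * c - b * d) * e - (a * d + b * c) * f ≡ a * (c * e - d * f) - b * (c * f + d * e)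
  re-part = solve-∀
  im-part : ∀ a b c d e f → (a * c - b * d) * f + (a * d + b * c) * e ≡ a * (c * f + d * e) + b * (c * e - d * f)
  im-part = solve-∀

*ᵍ-comm : Commutative _*ᵍ_
*ᵍ-comm (a +i b) (c +i d) = cong₂ _+i_ (re-part a b c d) (im-part a b c d)
  where
  re-part : ∀ a b c d → a * c - b * d ≡ c * a - d * b
  re-part = solve-∀
  im-part : ∀ a b c d → a * d + b * c ≡ c * b + d * a
  im-part = solve-∀

*ᵍ-identityˡ : LeftIdentity 1ᵍ _*ᵍ_
*ᵍ-identityˡ (a +i b) = cong₂ _+i_ (re-part a b) (im-part a b)
  where
  re-part : ∀ a b → + 1 * a - + 0 * b ≡ a
  re-part = solve-∀
  im-part : ∀ a b → + 1 * b + + 0 * a ≡ b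
  im-part = solve-∀

*ᵍ-distribˡ-+ᵍ : _*ᵍ_ DistributesOverˡ _+ᵍ_
*ᵍ-distribˡ-+ᵍ (a +i b) (c +i d) (e +i f) = cong₂ _+i_ (re-part a b c d e f) (im-part a b c d e f)
  where
  re-part : ∀ a b c d e f → a * (c + e) - b * (d + f) ≡ (a * c - b * d) + (a * e - b * f)
  re-part = solve-∀
  im-part : ∀ a b c d e f → a * (d + f) + b * (c + e) ≡ (a * d + b * c) + (a * f + b * e)
  im-part = solve-∀

+ᵍ-*ᵍ-isCommutativeRing : IsCommutativeRing _+ᵍ_ _*ᵍ_ -ᵍ_ 0ᵍ 1ᵍ
+ᵍ-*ᵍ-isCommutativeRing = record
  { isRing = record
    { +-isAbelianGroup = record
      { isGroup = record
        { isMonoid = record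
          { isSemigroup = record
            { isMagma = record { isEquivalence = isEquivalence ; ∙-cong = cong₂ _+ᵍ_ }
            ; assoc   = +ᵍ-assoc
            }
          ; identity = comm∧idˡ⇒id +ᵍ-comm +ᵍ-identityˡ
          }
        ; inverse = comm∧invˡ⇒inv +ᵍ-comm -ᵍ-inverseˡ
        ; ⁻¹-cong = cong (-ᵍ_)
        }
      ; comm = +ᵍ-comm
      }
    ; *-cong     = cong₂ _*ᵍ_
    ; *-assoc    = *ᵍ-assoc
    ; *-identity = comm∧idˡ⇒id *ᵍ-comm *ᵍ-identityˡ
    ; distrib    = *ᵍ-distribˡ-+ᵍ , comm∧distrˡ⇒distrʳ *ᵍ-comm *ᵍ-distribˡ-+ᵍ
    }
  ; *-comm = *ᵍ-comm
  }

+ᵍ-*ᵍ-commutativeRing : CommutativeRing 0ℓ 0ℓ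
+ᵍ-*ᵍ-commutativeRing = record { isCommutativeRing = +ᵍ-*ᵍ-isCommutativeRing }

open CommutativeRing +ᵍ-*ᵍ-commutativeRing using (zeroˡ; zeroʳ; +-identityʳ; -‿inverseʳ)
module GIProperties = RingProperties (CommutativeRing.ring +ᵍ-*ᵍ-commutativeRing)

-- Without a zero test the solver cannot cancel coefficients, and det-· would fail.
+ᵍ-*ᵍ-almostCommutativeRing : AlmostCommutativeRing 0ℓ 0ℓ
+ᵍ-*ᵍ-almostCommutativeRing = fromCommutativeRing +ᵍ-*ᵍ-commutativeRing is-zero
  where
  is-zero : ∀ z → Maybe (0ᵍ ≡ z)
  is-zero ((+ 0) +i (+ 0)) = just refl
  is-zero _                = nothing

norm : GI → ℤ
norm (a +i b) = a * a + b * b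

norm-*ᵍ : ∀ z w → norm (z *ᵍ w) ≡ norm z * norm w
norm-*ᵍ (a +i b) (c +i d) = brahmagupta a b c d
  where
  brahmagupta : ∀ a b c d → (a * c - b * d) * (a * c - b * d) + (a * d + b * c) * (a * d + b * c)
                          ≡ (a * a + b * b) * (c * c + d * d)
  brahmagupta = solve-∀

i*i≡+∣i∣*∣i∣ : ∀ i → i * i ≡ + (∣ i ∣ ℕ.* ∣ i ∣)
i*i≡+∣i∣*∣i∣ i =
  trans (cong (ℤ._◃ (∣ i ∣ ℕ.* ∣ i ∣)) (Sign.s*s≡+ (ℤ.sign i))) (ℤ.+◃n≡+n (∣ i ∣ ℕ.* ∣ i ∣))

norm≡0⇒≡0ᵍ : ∀ z → norm z ≡ + 0 → z ≡ 0ᵍ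
norm≡0⇒≡0ᵍ (a +i b) eq =
  cong₂ _+i_ (∣i∣*∣i∣≡0⇒i≡0 a (ℕ.m+n≡0⇒m≡0 _ sum≡0)) (∣i∣*∣i∣≡0⇒i≡0 b (ℕ.m+n≡0⇒n≡0 _ sum≡0))
  where
  sum≡0 : ∣ a ∣ ℕ.* ∣ a ∣ ℕ.+ ∣ b ∣ ℕ.* ∣ b ∣ ≡ 0
  sum≡0 = ℤ.+-injective (begin
    + (∣ a ∣ ℕ.* ∣ a ∣ ℕ.+ ∣ b ∣ ℕ.* ∣ b ∣)        ≡⟨ ℤ.pos-+ (∣ a ∣ ℕ.* ∣ a ∣) (∣ b ∣ ℕ.* ∣ b ∣) ⟩
    + (∣ a ∣ ℕ.* ∣ a ∣) + + (∣ b ∣ ℕ.* ∣ b ∣)      ≡⟨ cong₂ _+_ (i*i≡+∣i∣*∣i∣ a) (i*i≡+∣i∣*∣i∣ b) ⟨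
    a * a + b * b                                ≡⟨ eq ⟩
    + 0                                          ∎)
    where open ≡-Reasoning
  ∣i∣*∣i∣≡0⇒i≡0 : ∀ i → ∣ i ∣ ℕ.* ∣ i ∣ ≡ 0 → i ≡ + 0
  ∣i∣*∣i∣≡0⇒i≡0 i eq = ℤ.∣i∣≡0⇒i≡0 (Sum.reduce (ℕ.m*n≡0⇒m≡0∨n≡0 ∣ i ∣ eq))

z*w≡0⇒z≡0∨w≡0 : ∀ z w → z *ᵍ w ≡ 0ᵍ → z ≡ 0ᵍ ⊎ w ≡ 0ᵍ
z*w≡0⇒z≡0∨w≡0 z w eq = Sum.map (norm≡0⇒≡0ᵍ z) (norm≡0⇒≡0ᵍ w)
  (ℤ.i*j≡0⇒i≡0∨j≡0 (norm z) (trans (sym (norm-*ᵍ z w)) (cong norm eq)))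

*ᵍ-cancelʳ : ∀ {w} z z' → w ≢ 0ᵍ → z *ᵍ w ≡ z' *ᵍ w → z ≡ z'
*ᵍ-cancelʳ {w} z z' w≢0 eq =
  GIProperties.x∙y⁻¹≈ε⇒x≈y z z' (Sum.[ id , ⊥-elim ∘ w≢0 ]′ (z*w≡0⇒z≡0∨w≡0 (z -ᵍ z') w [z-z']w≡0))
  where
  [z-z']w≡0 : (z -ᵍ z') *ᵍ w ≡ 0ᵍ
  [z-z']w≡0 = begin
    (z -ᵍ z') *ᵍ w          ≡⟨ GIProperties.[y-z]x≈yx-zx w z z' ⟩
    z *ᵍ w -ᵍ z' *ᵍ w       ≡⟨ cong (_-ᵍ z' *ᵍ w) eq ⟩
    z' *ᵍ w -ᵍ z' *ᵍ w      ≡⟨ -‿inverseʳ (z' *ᵍ w) ⟩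
    0ᵍ                      ∎
    where open ≡-Reasoning

-- 2 × 2 matrices over ℤ[i]

mat-cong : ∀ {a b c d a' b' c' d'} → a ≡ a' → b ≡ b' → c ≡ c' → d ≡ d' → mat a b c d ≡ mat a' b' c' d'
mat-cong refl refl refl refl = refl

·-assoc : ∀ g h k → (g · h) · k ≡ g · (h · k)
·-assoc (mat a₁ b₁ c₁ d₁) (mat a₂ b₂ c₂ d₂) (mat a₃ b₃ c₃ d₃) =
  mat-cong (entry a₁ a₂ b₁ c₂ a₃ b₂ d₂ c₃) (entry a₁ a₂ b₁ c₂ b₃ b₂ d₂ d₃)
           (entry c₁ a₂ d₁ c₂ a₃ b₂ d₂ c₃) (entry c₁ a₂ d₁ c₂ b₃ b₂ d₂ d₃)
  where
  entry : ∀ p q r s t u v w → (p *ᵍ q +ᵍ r *ᵍ s) *ᵍ t +ᵍ (p *ᵍ u +ᵍ r *ᵍ v) *ᵍ w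
                            ≡ p *ᵍ (q *ᵍ t +ᵍ u *ᵍ w) +ᵍ r *ᵍ (s *ᵍ t +ᵍ v *ᵍ w)
  entry = Solver.solve-∀ +ᵍ-*ᵍ-almostCommutativeRing

·-identityʳ : ∀ g → g · matI ≡ g
·-identityʳ (mat a b c d) = mat-cong (left a b) (right a b) (left c d) (right c d)
  where
  left : ∀ p q → p *ᵍ 1ᵍ +ᵍ q *ᵍ 0ᵍ ≡ p
  left = Solver.solve-∀ +ᵍ-*ᵍ-almostCommutativeRing
  right : ∀ p q → p *ᵍ 0ᵍ +ᵍ q *ᵍ 1ᵍ ≡ q
  right = Solver.solve-∀ +ᵍ-*ᵍ-almostCommutativeRing

det-· : ∀ g h → det (g · h) ≡ det g *ᵍ det h
det-· (mat a b c d) (mat e f g h) = binet a b c d e f g h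
  where
  -- Written with _+ᵍ_ and -ᵍ_, which det unfolds to, because the solver does not recognise _-ᵍ_.
  binet : ∀ a b c d e f g h →
    (a *ᵍ e +ᵍ b *ᵍ g) *ᵍ (c *ᵍ f +ᵍ d *ᵍ h) +ᵍ -ᵍ ((a *ᵍ f +ᵍ b *ᵍ h) *ᵍ (c *ᵍ e +ᵍ d *ᵍ g))
      ≡ (a *ᵍ d +ᵍ -ᵍ (b *ᵍ c)) *ᵍ (e *ᵍ h +ᵍ -ᵍ (f *ᵍ g))
  binet = Solver.solve-∀ +ᵍ-*ᵍ-almostCommutativeRing

SL₂-· : ∀ g h → SL₂ g → SL₂ h → SL₂ (g · h)
SL₂-· g h det-g≡1 det-h≡1 = begin
  det (g · h)       ≡⟨ det-· g h ⟩
  det g *ᵍ det h    ≡⟨ cong₂ _*ᵍ_ det-g≡1 det-h≡1 ⟩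
  1ᵍ *ᵍ 1ᵍ          ≡⟨⟩
  1ᵍ                ∎
  where open ≡-Reasoning

row-·α-injective : ∀ {m x k p q p' q'} → m ≢ 0ᵍ → k ≢ 0ᵍ →
  p *ᵍ m +ᵍ q *ᵍ 0ᵍ ≡ p' *ᵍ m +ᵍ q' *ᵍ 0ᵍ → p *ᵍ x +ᵍ q *ᵍ k ≡ p' *ᵍ x +ᵍ q' *ᵍ k → p ≡ p' × q ≡ q'
row-·α-injective {m} {x} {k} {p} {q} {p'} {q'} m≢0 k≢0 eq₁ eq₂ = p≡p' , q≡q'
  where
  drop-zero : ∀ u v → u *ᵍ m +ᵍ v *ᵍ 0ᵍ ≡ u *ᵍ m
  drop-zero u v = trans (cong (u *ᵍ m +ᵍ_) (zeroʳ v)) (+-identityʳ (u *ᵍ m))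
  p≡p' : p ≡ p'
  p≡p' = *ᵍ-cancelʳ p p' m≢0 (trans (sym (drop-zero p q)) (trans eq₁ (drop-zero p' q')))
  q≡q' : q ≡ q'
  q≡q' = *ᵍ-cancelʳ q q' k≢0 (GIProperties.+-cancelˡ (p' *ᵍ x) (q *ᵍ k) (q' *ᵍ k)
           (trans (cong (λ u → u *ᵍ x +ᵍ q *ᵍ k) (sym p≡p')) eq₂))

·α-injective : ∀ {m x k} g g' → m ≢ 0ᵍ → k ≢ 0ᵍ → g · α m x k ≡ g' · α m x k → g ≡ g'
·α-injective (mat a b c d) (mat a' b' c' d') m≢0 k≢0 eq =
  let a≡a' , b≡b' = row-·α-injective m≢0 k≢0 (cong M2.a eq) (cong M2.b eq)
      c≡c' , d≡d' = row-·α-injective m≢0 k≢0 (cong M2.c eq) (cong M2.d eq)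
  in mat-cong a≡a' b≡b' c≡c' d≡d'

-- Reduction modulo 1 + i

-- ℤ[i]/(1 + i) ≅ 𝔽₂ because i ≡ 1 modulo 1 + i.
red : GI → Parity
red (a +i b) = parity (a + b)

red-+ : ∀ z w → red (z +ᵍ w) ≡ red z ℙ.+ red w
red-+ (a +i b) (c +i d) = trans (cong parity (regroup a b c d)) (parity-+ (a + b) (c + d))
  where
  regroup : ∀ a b c d → (a + c) + (b + d) ≡ (a + b) + (c + d)
  regroup = solve-∀

red-neg : ∀ z → red (-ᵍ z) ≡ red z
red-neg (a +i b) = trans (cong parity (sym (ℤ.neg-distrib-+ a b))) (parity-neg (a + b))

red-- : ∀ z w → red (z -ᵍ w) ≡ red z ℙ.+ red w
red-- z w = trans (red-+ z (-ᵍ w)) (cong (red z ℙ.+_) (red-neg w))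

red-* : ∀ z w → red (z *ᵍ w) ≡ red z ℙ.* red w
red-* (a +i b) (c +i d) = begin
  parity ((a * c - b * d) + (a * d + b * c))             ≡⟨ cong parity (expand a b c d) ⟩
  parity ((a + b) * (c + d) + - (b * d + b * d))         ≡⟨ parity-+ ((a + b) * (c + d)) _ ⟩
  parity ((a + b) * (c + d)) ℙ.+ parity (- (b * d + b * d))
    ≡⟨ cong (parity ((a + b) * (c + d)) ℙ.+_) (trans (parity-neg (b * d + b * d)) (parity-i+i (b * d))) ⟩
  parity ((a + b) * (c + d)) ℙ.+ 0ℙ                      ≡⟨ ℙ.+-identityʳ _ ⟩
  parity ((a + b) * (c + d))                             ≡⟨ parity-* (a + b) (c + d) ⟩
  parity (a + b) ℙ.* parity (c + d)                      ∎
  where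
  open ≡-Reasoning
  expand : ∀ a b c d → (a * c - b * d) + (a * d + b * c) ≡ (a + b) * (c + d) + - (b * d + b * d)
  expand = solve-∀

-- If a + b = 2q then a + b i = (1 + i) (q + (b - q) i).
red≡0ℙ⇒1+𝐢∣ : ∀ z → red z ≡ 0ℙ → 1+𝐢 ∣ᵍ z
red≡0ℙ⇒1+𝐢∣ (a +i b) eq with parity≡0ℙ⇒even (a + b) eq
... | q , a+b≡q+q = q +i (b - q) , cong₂ _+i_ re-part (im-part b q)
  where
  re-part : a ≡ + 1 * q - + 1 * (b - q)
  re-part = begin
    a                           ≡⟨ add-sub a b ⟩
    (a + b) - b                 ≡⟨ cong (_- b) a+b≡q+q ⟩
    (q + q) - b                 ≡⟨ re-of-product q b ⟩
    + 1 * q - + 1 * (b - q)     ∎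
    where
    open ≡-Reasoning
    add-sub : ∀ a b → a ≡ (a + b) - b
    add-sub = solve-∀
    re-of-product : ∀ q b → (q + q) - b ≡ + 1 * q - + 1 * (b - q)
    re-of-product = solve-∀
  im-part : ∀ b q → b ≡ + 1 * (b - q) + + 1 * q
  im-part = solve-∀

1+𝐢∣⇒red≡0ℙ : ∀ {z} → 1+𝐢 ∣ᵍ z → red z ≡ 0ℙ
1+𝐢∣⇒red≡0ℙ (w , refl) = red-* 1+𝐢 w

RedIs⇒red≡ : ∀ z r → RedIs z r → red z ≡ red r
RedIs⇒red≡ z r 1+𝐢∣z-r = x∙y⁻¹≈ε⇒x≈y (red z) (red r) (trans (sym (red-- z r)) (1+𝐢∣⇒red≡0ℙ 1+𝐢∣z-r))
  where open GroupProperties ℙ.+-0-group using (x∙y⁻¹≈ε⇒x≈y)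

red≡⇒RedIs : ∀ z r → red z ≡ red r → RedIs z r
red≡⇒RedIs z r eq =
  red≡0ℙ⇒1+𝐢∣ (z -ᵍ r) (trans (red-- z r) (trans (cong (ℙ._+ red r) eq) (ℙ.p+p≡0ℙ (red r))))

record M2ℙ : Set where
  constructor matℙ
  field
    a b c d : Parity

matℙ-cong : ∀ {a b c d a' b' c' d'} → a ≡ a' → b ≡ b' → c ≡ c' → d ≡ d' → matℙ a b c d ≡ matℙ a' b' c' d'
matℙ-cong refl refl refl refl = refl

infixl 7 _·ℙ_
_·ℙ_ : M2ℙ → M2ℙ → M2ℙ
matℙ a₁ b₁ c₁ d₁ ·ℙ matℙ a₂ b₂ c₂ d₂ =
  matℙ ((a₁ ℙ.* a₂) ℙ.+ (b₁ ℙ.* c₂)) ((a₁ ℙ.* b₂) ℙ.+ (b₁ ℙ.* d₂))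
       ((c₁ ℙ.* a₂) ℙ.+ (d₁ ℙ.* c₂)) ((c₁ ℙ.* b₂) ℙ.+ (d₁ ℙ.* d₂))

detℙ : M2ℙ → Parity
detℙ (matℙ a b c d) = (a ℙ.* d) ℙ.+ (b ℙ.* c)

redᴹ : M2 → M2ℙ
redᴹ (mat a b c d) = matℙ (red a) (red b) (red c) (red d)

redᴹ-· : ∀ g h → redᴹ (g · h) ≡ redᴹ g ·ℙ redᴹ h
redᴹ-· (mat a₁ b₁ c₁ d₁) (mat a₂ b₂ c₂ d₂) =
  matℙ-cong (entry a₁ a₂ b₁ c₂) (entry a₁ b₂ b₁ d₂) (entry c₁ a₂ d₁ c₂) (entry c₁ b₂ d₁ d₂)
  where
  entry : ∀ p q r s → red (p *ᵍ q +ᵍ r *ᵍ s) ≡ (red p ℙ.* red q) ℙ.+ (red r ℙ.* red s)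
  entry p q r s = trans (red-+ (p *ᵍ q) (r *ᵍ s)) (cong₂ ℙ._+_ (red-* p q) (red-* r s))

red-det : ∀ g → red (det g) ≡ detℙ (redᴹ g)
red-det (mat a b c d) = trans (red-- (a *ᵍ d) (b *ᵍ c)) (cong₂ ℙ._+_ (red-* a d) (red-* b c))

SL₂⇒detℙ≡1ℙ : ∀ g → SL₂ g → detℙ (redᴹ g) ≡ 1ℙ
SL₂⇒detℙ≡1ℙ g det-g≡1 = trans (sym (red-det g)) (cong red det-g≡1)

RedMatIs⇒redᴹ≡ : ∀ M R → RedMatIs M R → redᴹ M ≡ redᴹ R
RedMatIs⇒redᴹ≡ (mat a b c d) (mat a' b' c' d') (ra , rb , rc , rd) =
  matℙ-cong (RedIs⇒red≡ a a' ra) (RedIs⇒red≡ b b' rb) (RedIs⇒red≡ c c' rc) (RedIs⇒red≡ d d' rd)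

redᴹ≡⇒RedMatIs : ∀ M R → redᴹ M ≡ redᴹ R → RedMatIs M R
redᴹ≡⇒RedMatIs (mat a b c d) (mat a' b' c' d') eq =
  red≡⇒RedIs a a' (cong M2ℙ.a eq) , red≡⇒RedIs b b' (cong M2ℙ.b eq) ,
  red≡⇒RedIs c c' (cong M2ℙ.c eq) , red≡⇒RedIs d d' (cong M2ℙ.d eq)

-- The subgroup Ξ₁₂ and its right cosets

OneOf : M2 → M2 → M2ℙ → Set
OneOf R S p = p ≡ redᴹ R ⊎ p ≡ redᴹ S

H₁₂ H₁ H₂ : M2ℙ → Set
H₁₂ = OneOf matI matW
H₁  = OneOf mat0111 mat1101
H₂  = OneOf mat1110 mat1011

SL₂𝔽₂-classification : ∀ p → detℙ p ≡ 1ℙ → H₁ p ⊎ H₂ p ⊎ H₁₂ p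
SL₂𝔽₂-classification (matℙ 0ℙ 0ℙ _  _ ) ()
SL₂𝔽₂-classification (matℙ 0ℙ 1ℙ 0ℙ _ ) ()
SL₂𝔽₂-classification (matℙ 0ℙ 1ℙ 1ℙ 0ℙ) _ = inj₂ (inj₂ (inj₂ refl))
SL₂𝔽₂-classification (matℙ 0ℙ 1ℙ 1ℙ 1ℙ) _ = inj₁ (inj₁ refl)
SL₂𝔽₂-classification (matℙ 1ℙ 0ℙ _  0ℙ) ()
SL₂𝔽₂-classification (matℙ 1ℙ 0ℙ 0ℙ 1ℙ) _ = inj₂ (inj₂ (inj₁ refl))
SL₂𝔽₂-classification (matℙ 1ℙ 0ℙ 1ℙ 1ℙ) _ = inj₂ (inj₁ (inj₂ refl))
SL₂𝔽₂-classification (matℙ 1ℙ 1ℙ 0ℙ 0ℙ) ()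
SL₂𝔽₂-classification (matℙ 1ℙ 1ℙ 0ℙ 1ℙ) _ = inj₁ (inj₂ refl)
SL₂𝔽₂-classification (matℙ 1ℙ 1ℙ 1ℙ 0ℙ) _ = inj₂ (inj₁ (inj₁ refl))
SL₂𝔽₂-classification (matℙ 1ℙ 1ℙ 1ℙ 1ℙ) ()

H₁-H₂-disjoint : ∀ {p} → H₁ p → H₂ p → ⊥
H₁-H₂-disjoint (inj₁ refl) (inj₁ ())
H₁-H₂-disjoint (inj₁ refl) (inj₂ ())
H₁-H₂-disjoint (inj₂ refl) (inj₁ ())
H₁-H₂-disjoint (inj₂ refl) (inj₂ ())

H₁-H₁₂-disjoint : ∀ {p} → H₁ p → H₁₂ p → ⊥
H₁-H₁₂-disjoint (inj₁ refl) (inj₁ ())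
H₁-H₁₂-disjoint (inj₁ refl) (inj₂ ())
H₁-H₁₂-disjoint (inj₂ refl) (inj₁ ())
H₁-H₁₂-disjoint (inj₂ refl) (inj₂ ())

H₂-H₁₂-disjoint : ∀ {p} → H₂ p → H₁₂ p → ⊥
H₂-H₁₂-disjoint (inj₁ refl) (inj₁ ())
H₂-H₁₂-disjoint (inj₁ refl) (inj₂ ())
H₂-H₁₂-disjoint (inj₂ refl) (inj₁ ())
H₂-H₁₂-disjoint (inj₂ refl) (inj₂ ())

H₁₂-·-closed : ∀ {p q} → H₁₂ p → H₁₂ q → H₁₂ (p ·ℙ q)
H₁₂-·-closed (inj₁ refl) (inj₁ refl) = inj₁ refl
H₁₂-·-closed (inj₁ refl) (inj₂ refl) = inj₂ refl
H₁₂-·-closed (inj₂ refl) (inj₁ refl) = inj₂ refl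
H₁₂-·-closed (inj₂ refl) (inj₂ refl) = inj₁ refl

Ξ⟨_,_⟩ : M2 → M2 → M2 → Set
Ξ⟨ R , S ⟩ M = SL₂ M × (RedMatIs M R ⊎ RedMatIs M S)

Ξ⇒OneOf : ∀ R S M → Ξ⟨ R , S ⟩ M → OneOf R S (redᴹ M)
Ξ⇒OneOf R S M (_ , r) = Sum.map (RedMatIs⇒redᴹ≡ M R) (RedMatIs⇒redᴹ≡ M S) r

OneOf⇒Ξ : ∀ R S M → SL₂ M → OneOf R S (redᴹ M) → Ξ⟨ R , S ⟩ M
OneOf⇒Ξ R S M sl r = sl , Sum.map (redᴹ≡⇒RedMatIs M R) (redᴹ≡⇒RedMatIs M S) r

SL₂-partition : SL₂ ≐ (λ M → Ξ₁ M ⊎ Ξ₂ M ⊎ Ξ₁₂ M)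
SL₂-partition = split , λ _ → Sum.[ proj₁ , Sum.[ proj₁ , proj₁ ]′ ]′
  where
  split : SL₂ ⊆ (λ M → Ξ₁ M ⊎ Ξ₂ M ⊎ Ξ₁₂ M)
  split M sl = Sum.map (OneOf⇒Ξ mat0111 mat1101 M sl)
                       (Sum.map (OneOf⇒Ξ mat1110 mat1011 M sl) (OneOf⇒Ξ matI matW M sl))
                       (SL₂𝔽₂-classification (redᴹ M) (SL₂⇒detℙ≡1ℙ M sl))

Ξ-disjoint : ∀ R S R' S' → (∀ {p} → OneOf R S p → OneOf R' S' p → ⊥) → Disjoint Ξ⟨ R , S ⟩ Ξ⟨ R' , S' ⟩
Ξ-disjoint R S R' S' disjoint M ξ ξ' = disjoint (Ξ⇒OneOf R S M ξ) (Ξ⇒OneOf R' S' M ξ')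

Ξ₁-Ξ₂-disjoint : Disjoint Ξ₁ Ξ₂
Ξ₁-Ξ₂-disjoint = Ξ-disjoint mat0111 mat1101 mat1110 mat1011 H₁-H₂-disjoint

Ξ₁-Ξ₁₂-disjoint : Disjoint Ξ₁ Ξ₁₂
Ξ₁-Ξ₁₂-disjoint = Ξ-disjoint mat0111 mat1101 matI matW H₁-H₁₂-disjoint

Ξ₂-Ξ₁₂-disjoint : Disjoint Ξ₂ Ξ₁₂
Ξ₂-Ξ₁₂-disjoint = Ξ-disjoint mat1110 mat1011 matI matW H₂-H₁₂-disjoint

Ξ₁₂-·-closed : ∀ g h → Ξ₁₂ g → Ξ₁₂ h → Ξ₁₂ (g · h)
Ξ₁₂-·-closed g h ξ ζ = OneOf⇒Ξ matI matW (g · h) (SL₂-· g h (proj₁ ξ) (proj₁ ζ))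
  (subst H₁₂ (sym (redᴹ-· g h)) (H₁₂-·-closed (Ξ⇒OneOf matI matW g ξ) (Ξ⇒OneOf matI matW h ζ)))

Ξ-coset : ∀ R S g g⁻¹ → g⁻¹ · g ≡ matI → SL₂ g → SL₂ g⁻¹ →
  (∀ {p} → OneOf R S p → H₁₂ (p ·ℙ redᴹ g⁻¹)) → (∀ {p} → H₁₂ p → OneOf R S (p ·ℙ redᴹ g)) →
  Ξ⟨ R , S ⟩ ≐ (Ξ₁₂ ⋆ g)
Ξ-coset R S g g⁻¹ g⁻¹g≡I sl-g sl-g⁻¹ to-H₁₂ from-H₁₂ = ⊆-coset , coset-⊆
  where
  ⊆-coset : Ξ⟨ R , S ⟩ ⊆ (Ξ₁₂ ⋆ g)
  ⊆-coset M ξ = M · g⁻¹ , ξ' , M≡Mg⁻¹g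
    where
    ξ' : Ξ₁₂ (M · g⁻¹)
    ξ' = OneOf⇒Ξ matI matW (M · g⁻¹) (SL₂-· M g⁻¹ (proj₁ ξ) sl-g⁻¹)
           (subst H₁₂ (sym (redᴹ-· M g⁻¹)) (to-H₁₂ (Ξ⇒OneOf R S M ξ)))
    M≡Mg⁻¹g : M ≡ (M · g⁻¹) · g
    M≡Mg⁻¹g = begin
      M                ≡⟨ ·-identityʳ M ⟨
      M · matI         ≡⟨ cong (M ·_) g⁻¹g≡I ⟨
      M · (g⁻¹ · g)    ≡⟨ ·-assoc M g⁻¹ g ⟨
      (M · g⁻¹) · g    ∎
      where open ≡-Reasoning
  coset-⊆ : (Ξ₁₂ ⋆ g) ⊆ Ξ⟨ R , S ⟩
  coset-⊆ _ (h , ξ , refl) = OneOf⇒Ξ R S (h · g) (SL₂-· h g (proj₁ ξ) sl-g)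
    (subst (OneOf R S) (sym (redᴹ-· h g)) (from-H₁₂ (Ξ⇒OneOf matI matW h ξ)))

g₁ g₁⁻¹ g₂ g₂⁻¹ : M2
g₁   = mat 0ᵍ 1ᵍ (-ᵍ 1ᵍ) 1ᵍ
g₁⁻¹ = mat 1ᵍ (-ᵍ 1ᵍ) 1ᵍ 0ᵍ
g₂   = mat 1ᵍ 1ᵍ (-ᵍ 1ᵍ) 0ᵍ
g₂⁻¹ = mat 0ᵍ (-ᵍ 1ᵍ) 1ᵍ 1ᵍ

Ξ₁≐Ξ₁₂⋆g₁ : Ξ₁ ≐ (Ξ₁₂ ⋆ g₁)
Ξ₁≐Ξ₁₂⋆g₁ = Ξ-coset mat0111 mat1101 g₁ g₁⁻¹ refl refl refl to-H₁₂ from-H₁₂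
  where
  to-H₁₂ : ∀ {p} → H₁ p → H₁₂ (p ·ℙ redᴹ g₁⁻¹)
  to-H₁₂ (inj₁ refl) = inj₁ refl
  to-H₁₂ (inj₂ refl) = inj₂ refl
  from-H₁₂ : ∀ {p} → H₁₂ p → H₁ (p ·ℙ redᴹ g₁)
  from-H₁₂ (inj₁ refl) = inj₁ refl
  from-H₁₂ (inj₂ refl) = inj₂ refl

Ξ₂≐Ξ₁₂⋆g₂ : Ξ₂ ≐ (Ξ₁₂ ⋆ g₂)
Ξ₂≐Ξ₁₂⋆g₂ = Ξ-coset mat1110 mat1011 g₂ g₂⁻¹ refl refl refl to-H₁₂ from-H₁₂
  where
  to-H₁₂ : ∀ {p} → H₂ p → H₁₂ (p ·ℙ redᴹ g₂⁻¹)
  to-H₁₂ (inj₁ refl) = inj₁ refl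
  to-H₁₂ (inj₂ refl) = inj₂ refl
  from-H₁₂ : ∀ {p} → H₁₂ p → H₂ (p ·ℙ redᴹ g₂)
  from-H₁₂ (inj₁ refl) = inj₁ refl
  from-H₁₂ (inj₂ refl) = inj₂ refl

Ξ₁₂≐Ξ₁₂⋆I : Ξ₁₂ ≐ (Ξ₁₂ ⋆ matI)
Ξ₁₂≐Ξ₁₂⋆I = Ξ-coset matI matW matI matI refl refl refl right-unit right-unit
  where
  right-unit : ∀ {p} → H₁₂ p → H₁₂ (p ·ℙ redᴹ matI)
  right-unit h = H₁₂-·-closed h (inj₁ refl)

-- Right cosets of Ξ₁₂ and Ξ₁₂-orbits

⋆-mono : ∀ {S T} A → S ⊆ T → (S ⋆ A) ⊆ (T ⋆ A)
⋆-mono A S⊆T _ (g , s , eq) = g , S⊆T g s , eq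

⋆-cover : ∀ {S T U V} A → S ≐ (λ M → T M ⊎ U M ⊎ V M) →
          (S ⋆ A) ≐ (λ M → (T ⋆ A) M ⊎ (U ⋆ A) M ⊎ (V ⋆ A) M)
⋆-cover {S} {T} {U} {V} A (S⊆ , ⊆S) = split , λ M → Sum.[ ⋆-mono A (λ g → ⊆S g ∘ inj₁) M
                                      , Sum.[ ⋆-mono A (λ g → ⊆S g ∘ inj₂ ∘ inj₁) M
                                            , ⋆-mono A (λ g → ⊆S g ∘ inj₂ ∘ inj₂) M ]′ ]′
  where
  split : (S ⋆ A) ⊆ (λ M → (T ⋆ A) M ⊎ (U ⋆ A) M ⊎ (V ⋆ A) M)
  split _ (g , s , eq) =
    Sum.map (λ t → g , t , eq) (Sum.map (λ u → g , u , eq) (λ v → g , v , eq)) (S⊆ g s)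

⋆-disjoint : ∀ {S T} A → (∀ g g' → g · A ≡ g' · A → g ≡ g') → Disjoint S T → Disjoint (S ⋆ A) (T ⋆ A)
⋆-disjoint {T = T} A ·A-injective S∩T≡∅ _ (g , s , refl) (g' , t , eq) =
  S∩T≡∅ g s (subst T (sym (·A-injective g g' eq)) t)

⋆-coset : ∀ {S T} g A → S ≐ (T ⋆ g) → (S ⋆ A) ≐ (T ⋆ (g · A))
⋆-coset {S} {T} g A (S⊆ , ⊆S) = ⊆-orbit , orbit-⊆
  where
  ⊆-orbit : (S ⋆ A) ⊆ (T ⋆ (g · A))
  ⊆-orbit _ (h , s , refl) with S⊆ h s
  ... | t , t∈T , refl = t , t∈T , ·-assoc t g A
  orbit-⊆ : (T ⋆ (g · A)) ⊆ (S ⋆ A)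
  orbit-⊆ _ (t , t∈T , refl) = t · g , ⊆S (t · g) (t , t∈T , refl) , sym (·-assoc t g A)

Ξ₁₂⋆-closed : ∀ M₀ → ClosedΞ₁₂ (Ξ₁₂ ⋆ M₀)
Ξ₁₂⋆-closed M₀ h _ ξ (g , ζ , refl) = h · g , Ξ₁₂-·-closed h g ξ ζ , sym (·-assoc h g M₀)

coset-orbit : ∀ {S} g A → SL₂ g → S ≐ (Ξ₁₂ ⋆ g) → ClosedΞ₁₂ (S ⋆ A) × IsΞ₁₂OrbitIn (SL₂ ⋆ A) (S ⋆ A)
coset-orbit {S} g A sl-g S≐ = closed , (g · A , (g , sl-g , refl) , orbit)
  where
  orbit : (S ⋆ A) ≐ (Ξ₁₂ ⋆ (g · A))
  orbit = ⋆-coset g A S≐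
  closed : ClosedΞ₁₂ (S ⋆ A)
  closed h M ξ m = proj₂ orbit (h · M) (Ξ₁₂⋆-closed (g · A) h M ξ (proj₁ orbit M m))

*ᵍ≢0⇒factors≢0 : ∀ m k → m *ᵍ k ≢ 0ᵍ → m ≢ 0ᵍ × k ≢ 0ᵍ
*ᵍ≢0⇒factors≢0 m k mk≢0 = (λ { refl → mk≢0 (zeroˡ k) }) , (λ { refl → mk≢0 (zeroʳ m) })

mainTheorem8 : (Ω : GI → GI → Set) →
    (∀ y → ¬ (y ≡ 0ᵍ) → IsCompleteReps (Ω y) y) →
    (N m k x : GI) → ¬ (N ≡ 0ᵍ) → N ≡ m *ᵍ k → Ω k x →
    let A = α m x k
        X = SL₂ ⋆ A
        X₁ = Ξ₁ ⋆ A
        X₂ = Ξ₂ ⋆ A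
        X₁₂ = Ξ₁₂ ⋆ A
    in (X ≐ (λ M → X₁ M ⊎ X₂ M ⊎ X₁₂ M))
       × Disjoint X₁ X₂ × Disjoint X₁ X₁₂ × Disjoint X₂ X₁₂
       × ClosedΞ₁₂ X₁ × ClosedΞ₁₂ X₂ × ClosedΞ₁₂ X₁₂
       × IsΞ₁₂OrbitIn X X₁ × IsΞ₁₂OrbitIn X X₂ × IsΞ₁₂OrbitIn X X₁₂
mainTheorem8 _ _ _ m k x mk≢0 refl _ =
  ⋆-cover A SL₂-partition ,
  ⋆-disjoint A ·A-injective Ξ₁-Ξ₂-disjoint ,
  ⋆-disjoint A ·A-injective Ξ₁-Ξ₁₂-disjoint ,
  ⋆-disjoint A ·A-injective Ξ₂-Ξ₁₂-disjoint ,
  proj₁ orbit₁ , proj₁ orbit₂ , proj₁ orbit₁₂ ,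
  proj₂ orbit₁ , proj₂ orbit₂ , proj₂ orbit₁₂
  where
  A : M2
  A = α m x k
  ·A-injective : ∀ g g' → g · A ≡ g' · A → g ≡ g'
  ·A-injective g g' = uncurry (·α-injective g g') (*ᵍ≢0⇒factors≢0 m k mk≢0)
  orbit₁ : ClosedΞ₁₂ (Ξ₁ ⋆ A) × IsΞ₁₂OrbitIn (SL₂ ⋆ A) (Ξ₁ ⋆ A)
  orbit₁ = coset-orbit g₁ A refl Ξ₁≐Ξ₁₂⋆g₁
  orbit₂ : ClosedΞ₁₂ (Ξ₂ ⋆ A) × IsΞ₁₂OrbitIn (SL₂ ⋆ A) (Ξ₂ ⋆ A)
  orbit₂ = coset-orbit g₂ A refl Ξ₂≐Ξ₁₂⋆g₂
  orbit₁₂ : ClosedΞ₁₂ (Ξ₁₂ ⋆ A) × IsΞ₁₂OrbitIn (SL₂ ⋆ A) (Ξ₁₂ ⋆ A)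
  orbit₁₂ = coset-orbit matI A refl Ξ₁₂≐Ξ₁₂⋆I
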